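{- Let $n\ge 3$ and let $D_{2n}=\langle a,b: a^n=b^2=e,\ ab=ba^{ -1}\rangle$ be the dihedral group of order $2n$. The distance matrix of the enhanced power graph of $D_{2n}$ is non-singular.
   Context: For a group $G$, the enhanced power graph $\mathcal{G}_E(G)$ is the simple graph with vertex set $G$ in which distinct $a,b$ are adjacent if and only if $a,b\in\langle c\rangle$ for some $c\in G$. The distance matrix of a connected graph has $(u,v)$-entry equal to the graph distance $d(u,v)$ (and $0$ on the diagonal). -}

module Defs where

open import Data.Nat as ℕ using (ℕ; zero; suc; _≤_; NonZero; _%_)
open import Data.Nat.DivMod using (m%n<n)
open import Data.Fin as Fin using (Fin; toℕ; fromℕ<; splitAt; punchIn)
open import Data.Bool using (Bool; true; false; _xor_)
open import Data.Integer as ℤ using (ℤ; +_; -_)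
open import Data.Product using (Σ; ∃; _×_; _,_)
open import Data.Sum using (inj₁; inj₂)
open import Data.List using (List; foldr; allFin)
open import Relation.Binary.PropositionalEquality using (_≡_; _≢_)

-- The element  mk i s  stands for  a^i b^s  (i ∈ ℤ/n, s ∈ {0,1}).
-- Since b a^j = a^{-j} b, we get  (a^i b^s)(a^j b^t) = a^{i ± j} b^{s+t}
-- with sign − iff s = 1.

record Dih (n : ℕ) : Set where
  constructor mk
  field
    rot : Fin n
    ref : Bool

module _ {n : ℕ} {{_ : NonZero n}} where

  modN : ℕ → Fin n
  modN k = fromℕ< (m%n<n k n)

  negN : Fin n → Fin n
  negN i = modN (n ℕ.∸ toℕ i)

  addN : Fin n → Fin n → Fin n
  addN i j = modN (toℕ i ℕ.+ toℕ j)

  e : Dih n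
  e = mk (modN 0) false

  _·_ : Dih n → Dih n → Dih n
  mk i false · mk j t = mk (addN i j) t
  mk i true  · mk j t = mk (addN i (negN j)) (true xor t)

  _^_ : Dih n → ℕ → Dih n
  c ^ zero  = e
  c ^ suc k = c · (c ^ k)

  -- membership in the cyclic subgroup ⟨c⟩ (finite group: ⟨c⟩ = {c^k : k ∈ ℕ})
  _∈⟨_⟩ : Dih n → Dih n → Set
  x ∈⟨ c ⟩ = ∃ λ (k : ℕ) → x ≡ c ^ k

  Adj : Dih n → Dih n → Set
  Adj x y = x ≢ y × ∃ λ (c : Dih n) → (x ∈⟨ c ⟩) × (y ∈⟨ c ⟩)

  data Walk : Dih n → Dih n → ℕ → Set where
    here : ∀ {u} → Walk u u 0
    step : ∀ {u w v k} → Adj u w → Walk w v k → Walk u v (suc k)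

  IsDistance : (Dih n → Dih n → ℕ) → Set
  IsDistance D = ∀ u v → Walk u v (D u v) × (∀ k → Walk u v k → D u v ≤ k)

-- Enumeration of D_{2n}:  index i < n ↦ a^i,  index n + i ↦ a^i b.
-- (A bijection Fin (n + n) → Dih n; determinant is invariant under the
-- choice of ordering of the vertices.)
idx : {n : ℕ} → Fin (n ℕ.+ n) → Dih n
idx {n} k with splitAt n k
... | inj₁ i = mk i false
... | inj₂ i = mk i true

sign : ℕ → ℤ
sign zero = + 1
sign (suc k) = - sign k

det : {m : ℕ} → (Fin m → Fin m → ℤ) → ℤ
det {zero}  M = + 1
det {suc m} M =
  foldr ℤ._+_ (+ 0)
    (Data.List.map
      (λ j → sign (toℕ j) ℤ.* (M Fin.zero j ℤ.* det (λ r c → M (Fin.suc r) (punchIn j c))))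
      (allFin (suc m)))

-- The rotations of D₂ₙ form a clique in the enhanced power graph, since they all lie in ⟨a⟩,
-- while a reflection s generates only {e, s}: it is adjacent to e alone and at distance 2 from
-- every other vertex. So the distance matrix has a rigid block pattern in the R rotations and Q
-- reflections, and its determinant can be computed by elimination from the top-left corner.
-- Adding a neighbouring column to the first one makes the pivot ±1, and each Schur complement is
-- again of an explicit shape; what remains at the end splits into two matrices aI + bJ. This gives
--   det = −(−1)^(R−3) · (−2)^(Q−1) · (R(Q+2) − 2),
-- which is nonzero; for R = Q = n it is −2^(n−1) (n² + 2n − 2).

module Submission where

open import Defs
open import Data.Nat using (ℕ; NonZero; _≤_)
open import Data.Integer using (+_)
open import Relation.Binary.PropositionalEquality using (_≢_)

open import Data.Nat as ℕ using (zero; suc)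
import Data.Nat.Properties as ℕₚ
open import Data.Fin as Fin using (Fin; zero; suc; toℕ; inject₁; punchIn; punchOut; splitAt)
open import Data.Fin.Properties as Finₚ
  using (punchIn-injective; punchInᵢ≢i; punchIn-punchOut; toℕ-inject₁; suc-injective)
open import Data.Fin.Induction using (<-weakInduction)
open import Data.Nat.DivMod using (m%n<n; m<n⇒m%n≡m; n%n≡0; m%n%n≡m%n; %-distribˡ-+)
open import Data.Integer as ℤ using (ℤ; -_; _+_; _-_; _*_)
import Data.Integer.Properties as ℤₚ
open import Data.Integer.Tactic.RingSolver using (solve-∀)
open import Algebra.Properties.Semiring.Sum ℤₚ.+-*-semiring
  using (sum; sum-cong-≗; sum-replicate-zero; ∑-distrib-+; *-distribˡ-sum)
import Data.List as List
open import Data.List.Properties using (map-tabulate)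
open import Data.Product using (Σ-syntax; _×_; _,_; proj₁; proj₂)
open import Data.Sum using (_⊎_; inj₁; inj₂; map₁; [_,_]′)
open import Data.Empty using (⊥-elim)
open import Data.Bool using (true; false)
open import Relation.Nullary using (¬_; yes; no)
open import Relation.Binary.Definitions using (tri<; tri≈; tri>)
open import Relation.Binary.PropositionalEquality
  using (_≡_; _≗_; refl; sym; trans; cong; cong₂; subst; module ≡-Reasoning)
open import Function using (_∘_; case_of_)

open ≡-Reasoning

-- Laplace expansion and multilinearity

Matrix : ℕ → Set
Matrix m = Fin m → Fin m → ℤ

infix 4 _≋_

_≋_ : ∀ {m} → Matrix m → Matrix m → Set
M ≋ N = ∀ i j → M i j ≡ N i j

column : ∀ {m} → Fin m → Matrix m → Fin m → ℤ
column c M i = M i c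

AgreeOffColumn : ∀ {m} → Fin m → Matrix m → Matrix m → Set
AgreeOffColumn c M N = ∀ i j → j ≢ c → M i j ≡ N i j

minor : ∀ {m} → Fin (suc m) → Matrix (suc m) → Matrix m
minor j M r c = M (suc r) (punchIn j c)

laplaceTerm : ∀ {m} → Matrix (suc m) → Fin (suc m) → ℤ
laplaceTerm M j = sign (toℕ j) * (M zero j * det (minor j M))

sum-tabulate : ∀ {n} (f : Fin n → ℤ) → List.foldr _+_ (+ 0) (List.tabulate f) ≡ sum f
sum-tabulate {zero}  f = refl
sum-tabulate {suc n} f = cong (_+_ (f zero)) (sum-tabulate (f ∘ suc))

sum-linear : ∀ {n} (x y : ℤ) (f g : Fin n → ℤ) →
             sum (λ j → x * f j + y * g j) ≡ x * sum f + y * sum g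
sum-linear x y f g =
  trans (∑-distrib-+ (λ j → x * f j) (λ j → y * g j)) (sym (cong₂ _+_ (*-distribˡ-sum x f) (*-distribˡ-sum y g)))

sum-zero : ∀ {n} {f : Fin n → ℤ} → (∀ j → f j ≡ + 0) → sum f ≡ + 0
sum-zero {n} f≡0 = trans (sum-cong-≗ f≡0) (sum-replicate-zero n)

det-laplace : ∀ {m} (M : Matrix (suc m)) → det M ≡ sum (laplaceTerm M)
det-laplace M =
  trans (cong (List.foldr _+_ (+ 0)) (map-tabulate (λ j → j) (laplaceTerm M)))
        (sum-tabulate (laplaceTerm M))

det-cong : ∀ {m} {M N : Matrix m} → M ≋ N → det M ≡ det N
det-cong {zero}          _   = refl
det-cong {suc m} {M} {N} M≋N = begin
  det M               ≡⟨ det-laplace M ⟩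
  sum (laplaceTerm M) ≡⟨ sum-cong-≗ term≡ ⟩
  sum (laplaceTerm N) ≡⟨ det-laplace N ⟨
  det N               ∎
  where
  term≡ : ∀ j → laplaceTerm M j ≡ laplaceTerm N j
  term≡ j = cong₂ (λ a d → sign (toℕ j) * (a * d))
                  (M≋N zero j) (det-cong (λ r c → M≋N (suc r) (punchIn j c)))

det-linear-laplaceTerms : ∀ {m} (x y : ℤ) {M N P : Matrix (suc m)} →
                          (∀ j → laplaceTerm M j ≡ x * laplaceTerm N j + y * laplaceTerm P j) →
                          det M ≡ x * det N + y * det P
det-linear-laplaceTerms x y {M} {N} {P} term-linear = begin
  det M                                                 ≡⟨ det-laplace M ⟩
  sum (laplaceTerm M)                                   ≡⟨ sum-cong-≗ term-linear ⟩
  sum (λ j → x * laplaceTerm N j + y * laplaceTerm P j) ≡⟨ sum-linear x y (laplaceTerm N) (laplaceTerm P) ⟩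
  x * sum (laplaceTerm N) + y * sum (laplaceTerm P)
    ≡⟨ cong₂ (λ a b → x * a + y * b) (det-laplace N) (det-laplace P) ⟨
  x * det N + y * det P                                 ∎

det-linear-firstRow : ∀ {m} (x y : ℤ) {M N P : Matrix (suc m)} →
                      (∀ r j → M (suc r) j ≡ N (suc r) j) →
                      (∀ r j → M (suc r) j ≡ P (suc r) j) →
                      (∀ j → M zero j ≡ x * N zero j + y * P zero j) →
                      det M ≡ x * det N + y * det P
det-linear-firstRow x y {M} {N} {P} M~N M~P M₀≡ = det-linear-laplaceTerms x y {M} {N} {P} term-linear
  where
  term-linear : ∀ j → laplaceTerm M j ≡ x * laplaceTerm N j + y * laplaceTerm P j
  term-linear j = begin
    s * (M zero j * det (minor j M))
      ≡⟨ cong₂ (λ a d → s * (a * d)) (M₀≡ j) (det-cong (λ r c → M~N r (punchIn j c))) ⟩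
    s * ((x * N zero j + y * P zero j) * det (minor j N))
      ≡⟨ distribute s (N zero j) (P zero j) x y (det (minor j N)) ⟩
    x * (s * (N zero j * det (minor j N))) + y * (s * (P zero j * det (minor j N)))
      ≡⟨ cong (λ d → x * laplaceTerm N j + y * (s * (P zero j * d)))
              (det-cong (λ r c → trans (sym (M~N r (punchIn j c))) (M~P r (punchIn j c)))) ⟩
    x * laplaceTerm N j + y * laplaceTerm P j ∎
    where
    s = sign (toℕ j)
    distribute : ∀ s a b x y d → s * ((x * a + y * b) * d) ≡ x * (s * (a * d)) + y * (s * (b * d))
    distribute = solve-∀

det-linear-column : ∀ {m} (c : Fin m) (x y : ℤ) {M N P : Matrix m} →
                    AgreeOffColumn c M N → AgreeOffColumn c M P →
                    (∀ i → M i c ≡ x * N i c + y * P i c) →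
                    det M ≡ x * det N + y * det P
det-linear-column {suc m} c x y {M} {N} {P} M~N M~P Mc≡ = det-linear-laplaceTerms x y {M} {N} {P} term-linear
  where
  minor-at : ∀ {Q} → AgreeOffColumn c M Q → minor c M ≋ minor c Q
  minor-at M~Q r k = M~Q (suc r) (punchIn c k) (punchInᵢ≢i c k)

  minor-off : ∀ {j Q} (j≢c : j ≢ c) → AgreeOffColumn c M Q →
              AgreeOffColumn (punchOut j≢c) (minor j M) (minor j Q)
  minor-off {j} j≢c M~Q r k k≢c′ = M~Q (suc r) (punchIn j k) λ eq →
    k≢c′ (punchIn-injective j k _ (trans eq (sym (punchIn-punchOut j≢c))))

  term-linear : ∀ j → laplaceTerm M j ≡ x * laplaceTerm N j + y * laplaceTerm P j
  term-linear j with j Fin.≟ c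
  ... | yes refl = begin
    s * (M zero j * det (minor j M))
      ≡⟨ cong₂ (λ a d → s * (a * d)) (Mc≡ zero) (det-cong (minor-at M~N)) ⟩
    s * ((x * N zero j + y * P zero j) * det (minor j N))
      ≡⟨ distribute s (N zero j) (P zero j) x y (det (minor j N)) ⟩
    x * (s * (N zero j * det (minor j N))) + y * (s * (P zero j * det (minor j N)))
      ≡⟨ cong (λ d → x * laplaceTerm N j + y * (s * (P zero j * d)))
              (trans (sym (det-cong (minor-at M~N))) (det-cong (minor-at M~P))) ⟩
    x * laplaceTerm N j + y * laplaceTerm P j ∎
    where
    s = sign (toℕ j)
    distribute : ∀ s a b x y d → s * ((x * a + y * b) * d) ≡ x * (s * (a * d)) + y * (s * (b * d))
    distribute = solve-∀
  ... | no j≢c = begin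
    s * (M zero j * det (minor j M))
      ≡⟨ cong (λ d → s * (M zero j * d)) minor-linear ⟩
    s * (M zero j * (x * det (minor j N) + y * det (minor j P)))
      ≡⟨ distribute s (M zero j) x y (det (minor j N)) (det (minor j P)) ⟩
    x * (s * (M zero j * det (minor j N))) + y * (s * (M zero j * det (minor j P)))
      ≡⟨ cong₂ (λ a b → x * (s * (a * det (minor j N))) + y * (s * (b * det (minor j P))))
               (M~N zero j j≢c) (M~P zero j j≢c) ⟩
    x * laplaceTerm N j + y * laplaceTerm P j ∎
    where
    s = sign (toℕ j)
    distribute : ∀ s a x y d d′ → s * (a * (x * d + y * d′)) ≡ x * (s * (a * d)) + y * (s * (a * d′))
    distribute = solve-∀
    c′ = punchOut j≢c
    minor-linear : det (minor j M) ≡ x * det (minor j N) + y * det (minor j P)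
    minor-linear = det-linear-column c′ x y (minor-off j≢c M~N) (minor-off j≢c M~P) λ r →
      subst (λ k → M (suc r) k ≡ x * N (suc r) k + y * P (suc r) k)
            (sym (punchIn-punchOut j≢c)) (Mc≡ (suc r))

det-additive-column : ∀ {m} (c : Fin m) {M N P : Matrix m} →
                      AgreeOffColumn c M N → AgreeOffColumn c M P →
                      (∀ i → M i c ≡ N i c + P i c) → det M ≡ det N + det P
det-additive-column c {M} {N} {P} M~N M~P Mc≡ =
  trans (det-linear-column c (+ 1) (+ 1) M~N M~P (λ i → trans (Mc≡ i) (ones (N i c) (P i c))))
        (sym (ones (det N) (det P)))
  where
  ones : ∀ x y → x + y ≡ + 1 * x + + 1 * y
  ones = solve-∀

-- Alternation

punchIn-inject₁-suc : ∀ {m} (t k : Fin m) →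
                      punchIn (inject₁ t) k ≡ punchIn (suc t) k
                      ⊎ punchIn (inject₁ t) k ≡ suc t × punchIn (suc t) k ≡ inject₁ t
punchIn-inject₁-suc zero    zero    = inj₂ (refl , refl)
punchIn-inject₁-suc zero    (suc k) = inj₁ refl
punchIn-inject₁-suc (suc t) zero    = inj₁ refl
punchIn-inject₁-suc (suc t) (suc k) with punchIn-inject₁-suc t k
... | inj₁ eq          = inj₁ (cong suc eq)
... | inj₂ (eq₁ , eq₂) = inj₂ (cong suc eq₁ , cong suc eq₂)

punchIn-adjacentPair : ∀ {m} (j : Fin (suc (suc m))) (t : Fin (suc m)) →
                       j ≢ inject₁ t → j ≢ suc t →
                       Σ[ t′ ∈ Fin m ] punchIn j (inject₁ t′) ≡ inject₁ t × punchIn j (suc t′) ≡ suc t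
punchIn-adjacentPair zero          zero    j≢t _   = ⊥-elim (j≢t refl)
punchIn-adjacentPair zero          (suc t) _   _   = t , refl , refl
punchIn-adjacentPair (suc zero)    zero    _   j≢t = ⊥-elim (j≢t refl)
punchIn-adjacentPair {suc m} (suc (suc j)) zero _ _ = zero , refl , refl
punchIn-adjacentPair {suc m} (suc j) (suc t) j≢t j≢t+1
  with punchIn-adjacentPair j t (j≢t ∘ cong suc) (j≢t+1 ∘ cong suc)
... | t′ , eq₁ , eq₂ = suc t′ , cong suc eq₁ , cong suc eq₂

sum-adjacentPair : ∀ {n} (f : Fin (suc n) → ℤ) (t : Fin n) →
                   (∀ j → j ≢ inject₁ t → j ≢ suc t → f j ≡ + 0) →
                   f (inject₁ t) + f (suc t) ≡ + 0 → sum f ≡ + 0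
sum-adjacentPair {suc n} f zero f≡0 pair≡0 = begin
  f zero + (f (suc zero) + sum (λ j → f (suc (suc j))))
    ≡⟨ cong (λ r → f zero + (f (suc zero) + r)) (sum-zero λ j → f≡0 (suc (suc j)) (λ ()) (λ ())) ⟩
  f zero + (f (suc zero) + + 0) ≡⟨ cong (_+_ (f zero)) (ℤₚ.+-identityʳ _) ⟩
  f zero + f (suc zero)         ≡⟨ pair≡0 ⟩
  + 0                           ∎
sum-adjacentPair {suc n} f (suc t) f≡0 pair≡0 = begin
  f zero + sum (f ∘ suc) ≡⟨ cong₂ _+_ (f≡0 zero (λ ()) (λ ())) rest≡0 ⟩
  + 0 + + 0              ∎
  where
  rest≡0 = sum-adjacentPair (f ∘ suc) t
             (λ j j≢t j≢t+1 → f≡0 (suc j) (j≢t ∘ suc-injective) (j≢t+1 ∘ suc-injective)) pair≡0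

det-adjacentEqualColumns : ∀ {m} (t : Fin m) {M : Matrix (suc m)} →
                           column (inject₁ t) M ≗ column (suc t) M → det M ≡ + 0
det-adjacentEqualColumns {suc m} t {M} cols≡ =
  trans (det-laplace M) (sum-adjacentPair (laplaceTerm M) t others≡0 pair≡0)
  where
  others≡0 : ∀ j → j ≢ inject₁ t → j ≢ suc t → laplaceTerm M j ≡ + 0
  others≡0 j j≢t j≢t+1 with punchIn-adjacentPair j t j≢t j≢t+1
  ... | t′ , eq₁ , eq₂ = begin
    sign (toℕ j) * (M zero j * det (minor j M))
      ≡⟨ cong (λ d → sign (toℕ j) * (M zero j * d)) (det-adjacentEqualColumns t′ {minor j M} λ r →
           trans (cong (M (suc r)) eq₁) (trans (cols≡ (suc r)) (cong (M (suc r)) (sym eq₂)))) ⟩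
    sign (toℕ j) * (M zero j * + 0) ≡⟨ times-zero (sign (toℕ j)) (M zero j) ⟩
    + 0 ∎
    where
    times-zero : ∀ s a → s * (a * + 0) ≡ + 0
    times-zero = solve-∀
  minors≡ : minor (inject₁ t) M ≋ minor (suc t) M
  minors≡ r k with punchIn-inject₁-suc t k
  ... | inj₁ eq          = cong (M (suc r)) eq
  ... | inj₂ (eq₁ , eq₂) =
    trans (cong (M (suc r)) eq₁) (trans (sym (cols≡ (suc r))) (cong (M (suc r)) (sym eq₂)))
  pair≡0 : laplaceTerm M (inject₁ t) + laplaceTerm M (suc t) ≡ + 0
  pair≡0 rewrite toℕ-inject₁ t | cols≡ zero | det-cong minors≡ =
    cancel (sign (toℕ t)) (M zero (suc t) * det (minor (suc t) M))
    where
    cancel : ∀ s a → s * a + - s * a ≡ + 0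
    cancel = solve-∀

infixl 6 _[_]≔_

_[_]≔_ : ∀ {m} → Matrix m → Fin m → (Fin m → ℤ) → Matrix m
(M [ c ]≔ v) i j with j Fin.≟ c
... | yes _ = v i
... | no  _ = M i j

[]≔-updates : ∀ {m} (M : Matrix m) c v → column c (M [ c ]≔ v) ≗ v
[]≔-updates M c v i with c Fin.≟ c
... | yes _   = refl
... | no  c≢c = ⊥-elim (c≢c refl)

[]≔-minimal : ∀ {m} (M : Matrix m) c v → AgreeOffColumn c (M [ c ]≔ v) M
[]≔-minimal M c v i j j≢c with j Fin.≟ c
... | yes j≡c = ⊥-elim (j≢c j≡c)
... | no  _   = refl

inject₁≢suc : ∀ {m} (t : Fin m) → inject₁ t ≢ suc t
inject₁≢suc zero    ()
inject₁≢suc (suc t) eq = inject₁≢suc t (suc-injective eq)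

swapColumns : ∀ {m} → Fin m → Fin m → Matrix m → Matrix m
swapColumns a b M = M [ a ]≔ column b M [ b ]≔ column a M

-- With s = column a + column b, expanding 0 = det(s, s) in both columns leaves det M + det (swap M).
det-swapAdjacentColumns : ∀ {m} (t : Fin m) (M : Matrix (suc m)) →
                          det (swapColumns (inject₁ t) (suc t) M) ≡ - det M
det-swapAdjacentColumns t M = cancel (det M) (det (X cb ca)) (begin
  + 0                                                 ≡⟨ equal-a-b s ⟨
  det (X s s)                                         ≡⟨ additive-b s ca cb ⟩
  det (X s ca) + det (X s cb)                         ≡⟨ cong₂ _+_ (additive-a ca cb ca) (additive-a ca cb cb) ⟩
  (det (X ca ca) + det (X cb ca)) + (det (X ca cb) + det (X cb cb))
    ≡⟨ cong₂ (λ d d′ → (d + det (X cb ca)) + (det (X ca cb) + d′)) (equal-a-b ca) (equal-a-b cb) ⟩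
  (+ 0 + det (X cb ca)) + (det (X ca cb) + + 0)
    ≡⟨ cong (λ d → (+ 0 + det (X cb ca)) + (d + + 0)) (det-cong X≋M) ⟩
  (+ 0 + det (X cb ca)) + (det M + + 0)                ∎)
  where
  a = inject₁ t
  b = suc t
  ca = column a M
  cb = column b M
  s : Fin _ → ℤ
  s i = ca i + cb i

  X : (Fin _ → ℤ) → (Fin _ → ℤ) → Matrix _
  X u v = M [ a ]≔ u [ b ]≔ v

  X-b : ∀ u v → column b (X u v) ≗ v
  X-b u v = []≔-updates (M [ a ]≔ u) b v

  X-a : ∀ u v → column a (X u v) ≗ u
  X-a u v i = trans ([]≔-minimal (M [ a ]≔ u) b v i a (inject₁≢suc t)) ([]≔-updates M a u i)

  X-off : ∀ u v i j → j ≢ a → j ≢ b → X u v i j ≡ M i j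
  X-off u v i j j≢a j≢b = trans ([]≔-minimal (M [ a ]≔ u) b v i j j≢b) ([]≔-minimal M a u i j j≢a)

  X≋M : X ca cb ≋ M
  -- Deciding a ≟ j rather than j ≟ a keeps `with` from abstracting the test inside _[_]≔_.
  X≋M i j with a Fin.≟ j | b Fin.≟ j
  ... | yes refl | _        = X-a ca cb i
  ... | no _     | yes refl = X-b ca cb i
  ... | no a≢j   | no b≢j   = X-off ca cb i j (a≢j ∘ sym) (b≢j ∘ sym)

  additive-b : ∀ u v v′ → det (X u (λ i → v i + v′ i)) ≡ det (X u v) + det (X u v′)
  additive-b u v v′ = det-additive-column b {X u w} {X u v} {X u v′}
    (λ i j j≢b → trans ([]≔-minimal (M [ a ]≔ u) b w i j j≢b) (sym ([]≔-minimal (M [ a ]≔ u) b v i j j≢b)))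
    (λ i j j≢b → trans ([]≔-minimal (M [ a ]≔ u) b w i j j≢b) (sym ([]≔-minimal (M [ a ]≔ u) b v′ i j j≢b)))
    (λ i → trans (X-b u w i) (sym (cong₂ _+_ (X-b u v i) (X-b u v′ i))))
    where
    w = λ i → v i + v′ i

  agree-off-a : ∀ u u′ v → AgreeOffColumn a (X u v) (X u′ v)
  agree-off-a u u′ v i j j≢a with b Fin.≟ j
  ... | yes refl = trans (X-b u v i) (sym (X-b u′ v i))
  ... | no b≢j   = trans (X-off u v i j j≢a (b≢j ∘ sym)) (sym (X-off u′ v i j j≢a (b≢j ∘ sym)))

  additive-a : ∀ u u′ v → det (X (λ i → u i + u′ i) v) ≡ det (X u v) + det (X u′ v)
  additive-a u u′ v = det-additive-column a (agree-off-a _ u v) (agree-off-a _ u′ v)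
    (λ i → trans (X-a _ v i) (sym (cong₂ _+_ (X-a u v i) (X-a u′ v i))))

  equal-a-b : ∀ u → det (X u u) ≡ + 0
  equal-a-b u = det-adjacentEqualColumns t {X u u} (λ i → trans (X-a u u i) (sym (X-b u u i)))

  cancel : ∀ d d′ → + 0 ≡ (+ 0 + d′) + (d + + 0) → d′ ≡ - d
  cancel d d′ eq = trans (solve-d′ d d′) (trans (cong (_- d) (sym eq)) (ℤₚ.+-identityˡ (- d)))
    where
    solve-d′ : ∀ d d′ → d′ ≡ ((+ 0 + d′) + (d + + 0)) - d
    solve-d′ = solve-∀

det-equalColumns : ∀ {m} (t : Fin (suc m)) {M : Matrix (suc (suc m))} →
                   column zero M ≗ column (suc t) M → det M ≡ + 0
det-equalColumns t {M} = <-weakInduction P P-zero P-suc t M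
  where
  P : Fin _ → Set
  P t = ∀ M → column zero M ≗ column (suc t) M → det M ≡ + 0
  P-zero : P zero
  P-zero M = det-adjacentEqualColumns zero {M}
  P-suc : ∀ t → P (inject₁ t) → P (suc t)
  P-suc t hyp M cols≡ = begin
    det M             ≡⟨ ℤₚ.neg-involutive (det M) ⟨
    - - det M         ≡⟨ cong -_ (det-swapAdjacentColumns (suc t) M) ⟨
    - det M′          ≡⟨ cong -_ (hyp M′ cols′≡) ⟩
    + 0               ∎
    where
    a = suc (inject₁ t)
    b = suc (suc t)
    M₁ = M [ a ]≔ column b M
    M′ = swapColumns a b M
    cols′≡ : column zero M′ ≗ column a M′
    cols′≡ i = begin
      M′ i zero  ≡⟨ []≔-minimal M₁ b (column a M) i zero (λ ()) ⟩
      M₁ i zero  ≡⟨ []≔-minimal M a (column b M) i zero (λ ()) ⟩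
      M i zero   ≡⟨ cols≡ i ⟩
      M i b      ≡⟨ []≔-updates M a (column b M) i ⟨
      M₁ i a     ≡⟨ []≔-minimal M₁ b (column a M) i a (inject₁≢suc (suc t)) ⟨
      M′ i a     ∎

-- Column operations and pivoting

det-addColumnMultiple : ∀ {m} (l : ℤ) {c d : Fin m} {M M′ : Matrix m} →
                        AgreeOffColumn d M′ M → (∀ i → M′ i d ≡ M i d + l * M i c) →
                        det (M [ d ]≔ column c M) ≡ + 0 → det M′ ≡ det M
det-addColumnMultiple l {c} {d} {M} {M′} M′~M M′d≡ alternating = begin
  det M′                                       ≡⟨ det-linear-column d (+ 1) l M′~M M′~Mc M′d≡′ ⟩
  + 1 * det M + l * det (M [ d ]≔ column c M)  ≡⟨ cong (λ x → + 1 * det M + l * x) alternating ⟩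
  + 1 * det M + l * + 0                        ≡⟨ simplify (det M) l ⟩
  det M                                        ∎
  where
  M′~Mc : AgreeOffColumn d M′ (M [ d ]≔ column c M)
  M′~Mc i j j≢d = trans (M′~M i j j≢d) (sym ([]≔-minimal M d (column c M) i j j≢d))
  M′d≡′ : ∀ i → M′ i d ≡ + 1 * M i d + l * (M [ d ]≔ column c M) i d
  M′d≡′ i = trans (M′d≡ i)
    (cong₂ (λ a b → a + l * b) (sym (ℤₚ.*-identityˡ (M i d))) (sym ([]≔-updates M d (column c M) i)))
  simplify : ∀ x l → + 1 * x + l * + 0 ≡ x
  simplify = solve-∀

addToFirstColumn : ∀ {m} → ℤ → Matrix (suc (suc m)) → Matrix (suc (suc m))
addToFirstColumn l M i zero    = M i zero + l * M i (suc zero)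
addToFirstColumn l M i (suc c) = M i (suc c)

det-addToFirstColumn : ∀ {m} (l : ℤ) (M : Matrix (suc (suc m))) → det (addToFirstColumn l M) ≡ det M
det-addToFirstColumn l M =
  det-addColumnMultiple l {suc zero} {zero} {M} agree (λ _ → refl) (det-adjacentEqualColumns zero {M₁} cols≡)
  where
  agree : AgreeOffColumn zero (addToFirstColumn l M) M
  agree i zero    0≢0 = ⊥-elim (0≢0 refl)
  agree i (suc c) _   = refl
  M₁ = M [ zero ]≔ column (suc zero) M
  cols≡ : column zero M₁ ≗ column (suc zero) M₁
  cols≡ i = trans ([]≔-updates M zero (column (suc zero) M) i)
                  (sym ([]≔-minimal M zero (column (suc zero) M) i (suc zero) (λ ())))

addColumn0Multiples : ∀ {m} → (Fin m → ℤ) → Matrix (suc m) → Matrix (suc m)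
addColumn0Multiples w M i zero    = M i zero
addColumn0Multiples w M i (suc t) = M i (suc t) + w t * M i zero

infixl 8 _↾_

_↾_ : ∀ {m} → (Fin m → ℤ) → ℕ → Fin m → ℤ
(w ↾ k) t with toℕ t ℕ.<? k
... | yes _ = w t
... | no  _ = + 0

↾-below : ∀ {m} (w : Fin m → ℤ) {k} t → toℕ t ℕ.< k → (w ↾ k) t ≡ w t
↾-below w {k} t t<k with toℕ t ℕ.<? k
... | yes _   = refl
... | no  t≮k = ⊥-elim (t≮k t<k)

↾-above : ∀ {m} (w : Fin m → ℤ) {k} t → k ≤ toℕ t → (w ↾ k) t ≡ + 0
↾-above w {k} t k≤t with toℕ t ℕ.<? k
... | yes t<k = ⊥-elim (ℕₚ.<⇒≱ t<k k≤t)
... | no  _   = refl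

↾-suc : ∀ {m} (w : Fin m → ℤ) {k} t → toℕ t ≢ k → (w ↾ suc k) t ≡ (w ↾ k) t
↾-suc w {k} t t≢k with ℕₚ.<-cmp (toℕ t) k
... | tri< t<k _ _ = trans (↾-below w t (ℕₚ.m<n⇒m<1+n t<k)) (sym (↾-below w t t<k))
... | tri≈ _ t≡k _ = ⊥-elim (t≢k t≡k)
... | tri> _ _ t>k = trans (↾-above w t t>k) (sym (↾-above w t (ℕₚ.<⇒≤ t>k)))

det-addColumn0Multiples : ∀ {m} (w : Fin m → ℤ) (M : Matrix (suc m)) →
                          det (addColumn0Multiples w M) ≡ det M
det-addColumn0Multiples {zero}  w M = det-cong {M = addColumn0Multiples w M} {M} λ { i zero → refl }
det-addColumn0Multiples {suc m} w M =
  trans (det-cong {M = addColumn0Multiples w M} {addColumn0Multiples (w ↾ suc m) M}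
          (λ i → addColumns-cong i (λ t → sym (↾-below w t (Finₚ.toℕ<n t)))))
        (prefix (suc m) ℕₚ.≤-refl)
  where
  addColumns-cong : ∀ {w w′} i → w ≗ w′ → ∀ j → addColumn0Multiples w M i j ≡ addColumn0Multiples w′ M i j
  addColumns-cong i w≗w′ zero    = refl
  addColumns-cong i w≗w′ (suc t) = cong (λ x → M i (suc t) + x * M i zero) (w≗w′ t)

  prefix : ∀ k → k ≤ suc m → det (addColumn0Multiples (w ↾ k) M) ≡ det M
  prefix zero    _   = det-cong {M = addColumn0Multiples (w ↾ 0) M} {M} λ i → λ
    { zero    → refl
    ; (suc t) → trans (cong (λ x → M i (suc t) + x * M i zero) (↾-above w t ℕ.z≤n))
                      (add-zero (M i (suc t)) (M i zero)) }
    where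
    add-zero : ∀ a b → a + + 0 * b ≡ a
    add-zero = solve-∀
  prefix (suc k) k<m = begin
    det (addColumn0Multiples (w ↾ suc k) M)
      ≡⟨ det-addColumnMultiple (w t) {zero} {suc t} {A} agree column≡ alternating ⟩
    det A                                   ≡⟨ prefix k (ℕₚ.<⇒≤ k<m) ⟩
    det M                                   ∎
    where
    A = addColumn0Multiples (w ↾ k) M
    t = Fin.fromℕ< k<m
    t≡k : toℕ t ≡ k
    t≡k = Finₚ.toℕ-fromℕ< k<m
    agree : AgreeOffColumn (suc t) (addColumn0Multiples (w ↾ suc k) M) A
    agree i zero     _      = refl
    agree i (suc t′) t′≢t = cong (λ x → M i (suc t′) + x * M i zero)
      (↾-suc w t′ λ t′≡k → t′≢t (cong suc (Finₚ.toℕ-injective (trans t′≡k (sym t≡k)))))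
    column≡ : ∀ i → M i (suc t) + (w ↾ suc k) t * M i zero ≡ A i (suc t) + w t * A i zero
    column≡ i = begin
      M i (suc t) + (w ↾ suc k) t * M i zero
        ≡⟨ cong (λ x → M i (suc t) + x * M i zero) (↾-below w t (ℕ.s≤s (ℕₚ.≤-reflexive t≡k))) ⟩
      M i (suc t) + w t * M i zero
        ≡⟨ add-zero (M i (suc t)) (w t) (M i zero) ⟩
      M i (suc t) + + 0 * M i zero + w t * M i zero
        ≡⟨ cong (λ x → M i (suc t) + x * M i zero + w t * M i zero) (↾-above w t (ℕₚ.≤-reflexive (sym t≡k))) ⟨
      A i (suc t) + w t * A i zero ∎
      where
      add-zero : ∀ a x b → a + x * b ≡ a + + 0 * b + x * b
      add-zero = solve-∀
    alternating : det (A [ suc t ]≔ column zero A) ≡ + 0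
    alternating = det-equalColumns t {A [ suc t ]≔ column zero A} λ i →
      trans ([]≔-minimal A (suc t) (column zero A) i zero (λ ())) (sym ([]≔-updates A (suc t) (column zero A) i))

-- The pivot u is its own inverse (u * u ≡ + 1 in det-pivot).
schurComplement : ∀ {m} → ℤ → Matrix (suc m) → Matrix m
schurComplement u M r c = M (suc r) (suc c) - u * M zero (suc c) * M (suc r) zero

-- Clearing the first row with multiples of column 0 leaves a single Laplace term.
det-pivot : ∀ {m} (u : ℤ) (M : Matrix (suc m)) → M zero zero ≡ u → u * u ≡ + 1 →
            det M ≡ u * det (schurComplement u M)
det-pivot u M M₀₀≡u u²≡1 = begin
  det M                                               ≡⟨ det-addColumn0Multiples w M ⟨
  det B                                               ≡⟨ det-laplace B ⟩
  laplaceTerm B zero + sum (laplaceTerm B ∘ suc)      ≡⟨ cong (_+_ (laplaceTerm B zero)) (sum-zero rest≡0) ⟩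
  + 1 * (M zero zero * det (minor zero B)) + + 0
    ≡⟨ cong₂ (λ a d → + 1 * (a * d) + + 0) M₀₀≡u (det-cong minor≋schur) ⟩
  + 1 * (u * det (schurComplement u M)) + + 0         ≡⟨ unit-zero (u * det (schurComplement u M)) ⟩
  u * det (schurComplement u M)                       ∎
  where
  w : Fin _ → ℤ
  w t = - (u * M zero (suc t))
  B = addColumn0Multiples w M

  first-row≡0 : ∀ t → B zero (suc t) ≡ + 0
  first-row≡0 t = begin
    M zero (suc t) + - (u * M zero (suc t)) * M zero zero
      ≡⟨ cong (λ a → M zero (suc t) + - (u * M zero (suc t)) * a) M₀₀≡u ⟩
    M zero (suc t) + - (u * M zero (suc t)) * u          ≡⟨ regroup (M zero (suc t)) u ⟩
    M zero (suc t) - M zero (suc t) * (u * u)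
      ≡⟨ cong (λ x → M zero (suc t) - M zero (suc t) * x) u²≡1 ⟩
    M zero (suc t) - M zero (suc t) * + 1                ≡⟨ cancel (M zero (suc t)) ⟩
    + 0                                                  ∎
    where
    regroup : ∀ a u → a + - (u * a) * u ≡ a - a * (u * u)
    regroup = solve-∀
    cancel : ∀ a → a - a * + 1 ≡ + 0
    cancel = solve-∀

  rest≡0 : ∀ t → laplaceTerm B (suc t) ≡ + 0
  rest≡0 t = trans (cong (λ a → sign (toℕ (suc t)) * (a * det (minor (suc t) B))) (first-row≡0 t))
                   (times-zero (sign (toℕ (suc t))) (det (minor (suc t) B)))
    where
    times-zero : ∀ s d → s * (+ 0 * d) ≡ + 0
    times-zero = solve-∀

  minor≋schur : minor zero B ≋ schurComplement u M
  minor≋schur r c = regroup (M (suc r) (suc c)) u (M zero (suc c)) (M (suc r) zero)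
    where
    regroup : ∀ a u b c → a + - (u * b) * c ≡ a - u * b * c
    regroup = solve-∀

  unit-zero : ∀ x → + 1 * x + + 0 ≡ x
  unit-zero = solve-∀

-- Matrices aI + bJ

δ : ∀ {q} → Fin q → Fin q → ℤ
δ zero    zero    = + 1
δ zero    (suc _) = + 0
δ (suc _) zero    = + 0
δ (suc i) (suc j) = δ i j

δ-refl : ∀ {q} (i : Fin q) → δ i i ≡ + 1
δ-refl zero    = refl
δ-refl (suc i) = δ-refl i

δ-≢ : ∀ {q} {i j : Fin q} → i ≢ j → δ i j ≡ + 0
δ-≢ {i = zero}  {zero}  0≢0 = ⊥-elim (0≢0 refl)
δ-≢ {i = zero}  {suc _} _   = refl
δ-≢ {i = suc _} {zero}  _   = refl
δ-≢ {i = suc i} {suc j} i≢j = δ-≢ (i≢j ∘ cong suc)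

det-firstRow-x·e₀+y·𝟙 : ∀ {m} (x y : ℤ) (M : Matrix (suc m)) →
                        (∀ j → M zero j ≡ x * δ zero j + y) →
                        det M ≡ x * det (λ r c → M (suc r) (suc c))
                              + y * det (λ r c → M (suc r) (suc c) - M (suc r) zero)
det-firstRow-x·e₀+y·𝟙 x y M first-row = begin
  det M
    ≡⟨ det-linear-firstRow x y {M} {N} {P} (λ _ _ → refl) (λ _ _ → refl) first-row′ ⟩
  x * det N + y * det P
    ≡⟨ cong₂ (λ d d′ → x * d + y * d′) (det-pivot (+ 1) N refl refl) (det-pivot (+ 1) P refl refl) ⟩
  x * (+ 1 * det (schurComplement (+ 1) N)) + y * (+ 1 * det (schurComplement (+ 1) P))
    ≡⟨ cong₂ (λ d d′ → x * d + y * d′) (ℤₚ.*-identityˡ _) (ℤₚ.*-identityˡ _) ⟩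
  x * det (schurComplement (+ 1) N) + y * det (schurComplement (+ 1) P)
    ≡⟨ cong₂ (λ d d′ → x * d + y * d′) (det-cong schur-N) (det-cong schur-P) ⟩
  x * det (λ r c → M (suc r) (suc c)) + y * det (λ r c → M (suc r) (suc c) - M (suc r) zero) ∎
  where
  N P : Matrix _
  N zero    = δ zero
  N (suc r) = M (suc r)
  P zero    _ = + 1
  P (suc r)   = M (suc r)
  first-row′ : ∀ j → M zero j ≡ x * N zero j + y * P zero j
  first-row′ j = trans (first-row j) (cong (_+_ (x * δ zero j)) (sym (ℤₚ.*-identityʳ y)))
  schur-N : schurComplement (+ 1) N ≋ λ r c → M (suc r) (suc c)
  schur-N r c = simplify (M (suc r) (suc c)) (M (suc r) zero)
    where
    simplify : ∀ a b → a - + 1 * + 0 * b ≡ a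
    simplify = solve-∀
  schur-P : schurComplement (+ 1) P ≋ λ r c → M (suc r) (suc c) - M (suc r) zero
  schur-P r c = simplify (M (suc r) (suc c)) (M (suc r) zero)
    where
    simplify : ∀ a b → a - + 1 * + 1 * b ≡ a - b
    simplify = solve-∀

aI+bJ : (q : ℕ) → ℤ → ℤ → Matrix q
aI+bJ q a b i j = a * δ i j + b

det-aI+bJ-step : ∀ q a b → det (aI+bJ (suc q) a b) ≡ a * det (aI+bJ q a b) + b * det (aI+bJ q a (+ 0))
det-aI+bJ-step q a b =
  trans (det-firstRow-x·e₀+y·𝟙 a b (aI+bJ (suc q) a b) (λ _ → refl))
        (cong (λ d → a * det (aI+bJ q a b) + b * d) (det-cong {N = aI+bJ q a (+ 0)} λ r c → simplify a (δ r c) b))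
  where
  simplify : ∀ a d b → a * d + b - (a * + 0 + b) ≡ a * d + + 0
  simplify = solve-∀

det-aI : ∀ q a → det (aI+bJ q a (+ 0)) ≡ a ℤ.^ q
det-aI zero    a = refl
det-aI (suc q) a = begin
  det (aI+bJ (suc q) a (+ 0))                               ≡⟨ det-aI+bJ-step q a (+ 0) ⟩
  a * det (aI+bJ q a (+ 0)) + + 0 * det (aI+bJ q a (+ 0))   ≡⟨ cong (λ d → a * d + + 0 * d) (det-aI q a) ⟩
  a * a ℤ.^ q + + 0 * a ℤ.^ q                               ≡⟨ simplify a (a ℤ.^ q) ⟩
  a * a ℤ.^ q                                               ∎
  where
  simplify : ∀ a p → a * p + + 0 * p ≡ a * p
  simplify = solve-∀

det-aI+bJ : ∀ q a b → det (aI+bJ (suc q) a b) ≡ a ℤ.^ q * (a + + suc q * b)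
det-aI+bJ zero    a b = trans (det-aI+bJ-step zero a b) (simplify a b)
  where
  simplify : ∀ a b → a * + 1 + b * + 1 ≡ + 1 * (a + + 1 * b)
  simplify = solve-∀
det-aI+bJ (suc q) a b = begin
  det (aI+bJ (suc (suc q)) a b)                             ≡⟨ det-aI+bJ-step (suc q) a b ⟩
  a * det (aI+bJ (suc q) a b) + b * det (aI+bJ (suc q) a (+ 0))
    ≡⟨ cong₂ (λ x y → a * x + b * y) (det-aI+bJ q a b) (det-aI (suc q) a) ⟩
  a * (a ℤ.^ q * (a + + suc q * b)) + b * (a * a ℤ.^ q)     ≡⟨ simplify a b (+ suc q) (a ℤ.^ q) ⟩
  a * a ℤ.^ q * (a + (+ 1 + + suc q) * b)                   ∎
  where
  simplify : ∀ a b n p → a * (p * (a + n * b)) + b * (a * p) ≡ a * p * (a + (+ 1 + n) * b)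
  simplify = solve-∀

-- Elimination in the block pattern of the distance matrix

BlockEntries : ℕ → ℕ → Set
BlockEntries p q = Fin p ⊎ Fin q → Fin p ⊎ Fin q → ℤ

blocks : ∀ p {q} → BlockEntries p q → Matrix (p ℕ.+ q)
blocks p f i j = f (splitAt p i) (splitAt p j)

det-blocks-cong : ∀ p {q} {f g : BlockEntries p q} → (∀ x y → f x y ≡ g x y) →
                  det (blocks p f) ≡ det (blocks p g)
det-blocks-cong p f≡g = det-cong λ i j → f≡g (splitAt p i) (splitAt p j)

-- The Schur complement, on block indices, for the pivot u reached by adding l times column 1 to column 0.
pivotEntries : ∀ {p q} → ℤ → ℤ → BlockEntries (suc (suc p)) q → BlockEntries (suc p) q
pivotEntries l u f x y =
  f (map₁ suc x) (map₁ suc y)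
  - u * f (inj₁ zero) (map₁ suc y) * (f (map₁ suc x) (inj₁ zero) + l * f (map₁ suc x) (inj₁ (suc zero)))

det-blocks-pivot : ∀ {p q} (l u : ℤ) (f : BlockEntries (suc (suc p)) q) →
                   f (inj₁ zero) (inj₁ zero) + l * f (inj₁ zero) (inj₁ (suc zero)) ≡ u → u * u ≡ + 1 →
                   det (blocks (suc (suc p)) f) ≡ u * det (blocks (suc p) (pivotEntries l u f))
det-blocks-pivot l u f pivot≡u u²≡1 = begin
  det M                                              ≡⟨ det-addToFirstColumn l M ⟨
  det (addToFirstColumn l M)                         ≡⟨ det-pivot u (addToFirstColumn l M) pivot≡u u²≡1 ⟩
  u * det (schurComplement u (addToFirstColumn l M)) ∎
  where
  M = blocks _ f

-- Index inj₁ i is the rotation aⁱ (so inj₁ zero is e) and inj₂ i the reflection aⁱb.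
distanceBlocks : ∀ {r q} → BlockEntries (suc r) q
distanceBlocks (inj₁ i) (inj₁ j) = + 1 - δ i j
distanceBlocks (inj₁ i) (inj₂ _) = + 2 - δ zero i
distanceBlocks (inj₂ _) (inj₁ j) = + 2 - δ zero j
distanceBlocks (inj₂ i) (inj₂ j) = + 2 - + 2 * δ i j

-- The Schur complements met along the elimination: each pivot deletes a rotation, and on Γ it raises k by one.
reducedBlocks : ∀ {r q} → BlockEntries (suc r) q
reducedBlocks (inj₁ zero)    (inj₁ j) = - δ zero j
reducedBlocks (inj₁ zero)    (inj₂ _) = + 1
reducedBlocks (inj₁ (suc i)) (inj₁ j) = - (δ (suc i) j + + 1)
reducedBlocks (inj₁ (suc _)) (inj₂ _) = + 0
reducedBlocks (inj₂ _)       (inj₁ _) = - + 1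
reducedBlocks (inj₂ i)       (inj₂ j) = - (+ 2 * δ i j + + 1)

Γ : ℤ → ∀ {p q} → BlockEntries (suc p) q
Γ k (inj₁ zero)    (inj₁ j) = - (δ zero j + k)
Γ k (inj₁ zero)    (inj₂ _) = - k
Γ k (inj₁ (suc i)) (inj₁ j) = - (δ (suc i) j + + 1)
Γ k (inj₁ (suc _)) (inj₂ _) = - + 1
Γ k (inj₂ _)       (inj₁ _) = - + 1
Γ k (inj₂ i)       (inj₂ j) = - (+ 2 * δ i j + + 2)

pivot-distanceBlocks : ∀ {r q} x y → pivotEntries (+ 1) (+ 1) (distanceBlocks {suc (suc r)} {q}) x y ≡ reducedBlocks x y
pivot-distanceBlocks (inj₁ zero)    (inj₁ j) = simplify (δ zero j)
  where
  simplify : ∀ d → + 1 - d - + 1 * (+ 1 - + 0) * (+ 1 - + 0 + + 1 * (+ 1 - + 1)) ≡ - d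
  simplify = solve-∀
pivot-distanceBlocks (inj₁ zero)    (inj₂ _) = refl
pivot-distanceBlocks (inj₁ (suc i)) (inj₁ j) = simplify (δ (suc i) j)
  where
  simplify : ∀ d → + 1 - d - + 1 * (+ 1 - + 0) * (+ 1 - + 0 + + 1 * (+ 1 - + 0)) ≡ - (d + + 1)
  simplify = solve-∀
pivot-distanceBlocks (inj₁ (suc _)) (inj₂ _) = refl
pivot-distanceBlocks (inj₂ _)       (inj₁ _) = refl
pivot-distanceBlocks (inj₂ i)       (inj₂ j) = simplify (δ i j)
  where
  simplify : ∀ d → + 2 - + 2 * d - + 1 * (+ 2 - + 1) * (+ 2 - + 1 + + 1 * (+ 2 - + 0)) ≡ - (+ 2 * d + + 1)
  simplify = solve-∀

pivot-reducedBlocks : ∀ {r q} x y → pivotEntries (+ 0) (- + 1) (reducedBlocks {suc r} {q}) x y ≡ Γ (+ 1) x y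
pivot-reducedBlocks (inj₁ zero)    (inj₁ j) = simplify (δ zero j)
  where
  simplify : ∀ d → - (d + + 1) - - + 1 * - + 0 * (- (+ 0 + + 1) + + 0 * - (+ 1 + + 1)) ≡ - (d + + 1)
  simplify = solve-∀
pivot-reducedBlocks (inj₁ zero)    (inj₂ _) = refl
pivot-reducedBlocks (inj₁ (suc i)) (inj₁ j) = simplify (δ (suc i) j)
  where
  simplify : ∀ d → - (d + + 1) - - + 1 * - + 0 * (- (+ 0 + + 1) + + 0 * - (+ 0 + + 1)) ≡ - (d + + 1)
  simplify = solve-∀
pivot-reducedBlocks (inj₁ (suc _)) (inj₂ _) = refl
pivot-reducedBlocks (inj₂ _)       (inj₁ _) = refl
pivot-reducedBlocks (inj₂ i)       (inj₂ j) = simplify (δ i j)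
  where
  simplify : ∀ d → - (+ 2 * d + + 1) - - + 1 * + 1 * (- + 1 + + 0 * - + 1) ≡ - (+ 2 * d + + 2)
  simplify = solve-∀

pivot-Γ : ∀ k {p q} x y → pivotEntries (- + 1) (- + 1) (Γ k {suc p} {q}) x y ≡ Γ (k + + 1) x y
pivot-Γ k (inj₁ zero)    (inj₁ j) = simplify k (δ zero j)
  where
  simplify : ∀ k d → - (d + + 1) - - + 1 * - (+ 0 + k) * (- + 1 + - + 1 * - (+ 1 + + 1)) ≡ - (d + (k + + 1))
  simplify = solve-∀
pivot-Γ k (inj₁ zero)    (inj₂ _) = simplify k
  where
  simplify : ∀ k → - + 1 - - + 1 * - k * (- + 1 + - + 1 * - (+ 1 + + 1)) ≡ - (k + + 1)
  simplify = solve-∀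
pivot-Γ k (inj₁ (suc i)) (inj₁ j) = simplify k (δ (suc i) j)
  where
  simplify : ∀ k d → - (d + + 1) - - + 1 * - (+ 0 + k) * (- (+ 0 + + 1) + - + 1 * - (+ 0 + + 1)) ≡ - (d + + 1)
  simplify = solve-∀
pivot-Γ k (inj₁ (suc i)) (inj₂ _) = simplify k
  where
  simplify : ∀ k → - + 1 - - + 1 * - k * (- (+ 0 + + 1) + - + 1 * - (+ 0 + + 1)) ≡ - + 1
  simplify = solve-∀
pivot-Γ k (inj₂ _)       (inj₁ _) = simplify k
  where
  simplify : ∀ k → - + 1 - - + 1 * - (+ 0 + k) * (- + 1 + - + 1 * - + 1) ≡ - + 1
  simplify = solve-∀
pivot-Γ k (inj₂ i)       (inj₂ j) = simplify k (δ i j)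
  where
  simplify : ∀ k d → - (+ 2 * d + + 2) - - + 1 * - k * (- + 1 + - + 1 * - + 1) ≡ - (+ 2 * d + + 2)
  simplify = solve-∀

det-Γ : ∀ k p q → det (blocks (suc p) (Γ k {p} {suc q}))
                  ≡ (- + 1) ℤ.^ p * ((- + 2) ℤ.^ q * ((k + + p + + 2) * (+ suc q + + 2) - + 2))
det-Γ k zero q = begin
  det M                                      ≡⟨ det-firstRow-x·e₀+y·𝟙 (- + 1) (- k) M first-row ⟩
  - + 1 * det (λ r c → M (suc r) (suc c)) + - k * det (λ r c → M (suc r) (suc c) - M (suc r) zero)
    ≡⟨ cong₂ (λ d d′ → - + 1 * d + - k * d′) (det-cong {N = aI+bJ (suc q) (- + 2) (- + 2)} λ r c → as-aI+bJ₁ (δ r c))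
                                             (det-cong {N = aI+bJ (suc q) (- + 2) (- + 1)} λ r c → as-aI+bJ₂ (δ r c)) ⟩
  - + 1 * det (aI+bJ (suc q) (- + 2) (- + 2)) + - k * det (aI+bJ (suc q) (- + 2) (- + 1))
    ≡⟨ cong₂ (λ d d′ → - + 1 * d + - k * d′) (det-aI+bJ q (- + 2) (- + 2)) (det-aI+bJ q (- + 2) (- + 1)) ⟩
  - + 1 * (P * (- + 2 + Q * - + 2)) + - k * (P * (- + 2 + Q * - + 1))
    ≡⟨ collect k P Q ⟩
  + 1 * (P * ((k + + 0 + + 2) * (Q + + 2) - + 2)) ∎
  where
  M = blocks 1 (Γ k {0} {suc q})
  P = (- + 2) ℤ.^ q
  Q = + suc q
  first-row : ∀ j → M zero j ≡ - + 1 * δ zero j + - k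
  first-row zero    = entry₀₀ k
    where
    entry₀₀ : ∀ k → - (+ 1 + k) ≡ - + 1 * + 1 + - k
    entry₀₀ = solve-∀
  first-row (suc _) = entry₀ⱼ k
    where
    entry₀ⱼ : ∀ k → - k ≡ - + 1 * + 0 + - k
    entry₀ⱼ = solve-∀
  as-aI+bJ₁ : ∀ d → - (+ 2 * d + + 2) ≡ - + 2 * d + - + 2
  as-aI+bJ₁ = solve-∀
  as-aI+bJ₂ : ∀ d → - (+ 2 * d + + 2) - - + 1 ≡ - + 2 * d + - + 1
  as-aI+bJ₂ = solve-∀
  collect : ∀ k P Q → - + 1 * (P * (- + 2 + Q * - + 2)) + - k * (P * (- + 2 + Q * - + 1))
                      ≡ + 1 * (P * ((k + + 0 + + 2) * (Q + + 2) - + 2))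
  collect = solve-∀
det-Γ k (suc p) q = begin
  det (blocks (suc (suc p)) (Γ k))
    ≡⟨ det-blocks-pivot {p} {suc q} (- + 1) (- + 1) (Γ k) (pivot≡-1 k) refl ⟩
  - + 1 * det (blocks (suc p) (pivotEntries (- + 1) (- + 1) (Γ k)))
    ≡⟨ cong (- + 1 *_) (det-blocks-cong (suc p) (pivot-Γ k)) ⟩
  - + 1 * det (blocks (suc p) (Γ (k + + 1)))              ≡⟨ cong (- + 1 *_) (det-Γ (k + + 1) p q) ⟩
  - + 1 * (S * (P * ((k + + 1 + + p + + 2) * (Q + + 2) - + 2))) ≡⟨ regroup k (+ p) S P Q ⟩
  - + 1 * S * (P * ((k + (+ 1 + + p) + + 2) * (Q + + 2) - + 2)) ∎
  where
  S = (- + 1) ℤ.^ p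
  P = (- + 2) ℤ.^ q
  Q = + suc q
  pivot≡-1 : ∀ k → - (+ 1 + k) + - + 1 * - (+ 0 + k) ≡ - + 1
  pivot≡-1 = solve-∀
  regroup : ∀ k p S P Q → - + 1 * (S * (P * ((k + + 1 + p + + 2) * (Q + + 2) - + 2)))
                          ≡ - + 1 * S * (P * ((k + (+ 1 + p) + + 2) * (Q + + 2) - + 2))
  regroup = solve-∀

det-distanceBlocks : ∀ m q → det (blocks (3 ℕ.+ m) (distanceBlocks {suc (suc m)} {suc q}))
                             ≡ - ((- + 1) ℤ.^ m * ((- + 2) ℤ.^ q * (+ (3 ℕ.+ m) * + (3 ℕ.+ q) - + 2)))
det-distanceBlocks m q = begin
  det (blocks (3 ℕ.+ m) distanceBlocks)
    ≡⟨ det-blocks-pivot {suc m} {suc q} (+ 1) (+ 1) distanceBlocks refl refl ⟩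
  + 1 * det (blocks (2 ℕ.+ m) (pivotEntries (+ 1) (+ 1) distanceBlocks))
    ≡⟨ cong (+ 1 *_) (det-blocks-cong (2 ℕ.+ m) pivot-distanceBlocks) ⟩
  + 1 * det (blocks (2 ℕ.+ m) reducedBlocks)
    ≡⟨ cong (+ 1 *_) (det-blocks-pivot {m} {suc q} (+ 0) (- + 1) reducedBlocks refl refl) ⟩
  + 1 * (- + 1 * det (blocks (1 ℕ.+ m) (pivotEntries (+ 0) (- + 1) reducedBlocks)))
    ≡⟨ cong (λ d → + 1 * (- + 1 * d)) (det-blocks-cong (1 ℕ.+ m) pivot-reducedBlocks) ⟩
  + 1 * (- + 1 * det (blocks (1 ℕ.+ m) (Γ (+ 1))))       ≡⟨ cong (λ d → + 1 * (- + 1 * d)) (det-Γ (+ 1) m q) ⟩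
  + 1 * (- + 1 * (S * (P * ((+ 1 + + m + + 2) * (Q + + 2) - + 2)))) ≡⟨ regroup (+ m) (+ q) S P ⟩
  - (S * (P * ((+ 3 + + m) * (+ 3 + + q) - + 2)))          ∎
  where
  S = (- + 1) ℤ.^ m
  P = (- + 2) ℤ.^ q
  Q = + suc q
  regroup : ∀ m q S P → + 1 * (- + 1 * (S * (P * ((+ 1 + m + + 2) * (+ 1 + q + + 2) - + 2))))
                        ≡ - (S * (P * ((+ 3 + m) * (+ 3 + q) - + 2)))
  regroup = solve-∀

*-≢0 : ∀ {i j} → i ≢ + 0 → j ≢ + 0 → i * j ≢ + 0
*-≢0 {i} i≢0 j≢0 ij≡0 = [ i≢0 , j≢0 ]′ (ℤₚ.i*j≡0⇒i≡0∨j≡0 i ij≡0)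

^-≢0 : ∀ {i} n → i ≢ + 0 → i ℤ.^ n ≢ + 0
^-≢0 {i} n i≢0 = i≢0 ∘ ℤₚ.i^n≡0⇒i≡0 i n

-‿≢0 : ∀ {i} → i ≢ + 0 → - i ≢ + 0
-‿≢0 {i} i≢0 -i≡0 = i≢0 (trans (sym (ℤₚ.neg-involutive i)) (cong -_ -i≡0))

det-distanceBlocks≢0 : ∀ m q → det (blocks (3 ℕ.+ m) (distanceBlocks {suc (suc m)} {suc q})) ≢ + 0
det-distanceBlocks≢0 m q det≡0 =
  -‿≢0 (*-≢0 (^-≢0 m (λ ())) (*-≢0 (^-≢0 q (λ ())) (λ ()))) (trans (sym (det-distanceBlocks m q)) det≡0)

-- Distances in the enhanced power graph of D₂ₙ

module _ {n′ : ℕ} where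
  private
    n = suc n′

  toℕ-modN : ∀ k → toℕ (modN {n} k) ≡ k ℕ.% n
  toℕ-modN k = Finₚ.toℕ-fromℕ< (m%n<n k n)

  modN-toℕ : ∀ (i : Fin n) → modN (toℕ i) ≡ i
  modN-toℕ i = Finₚ.toℕ-injective (trans (toℕ-modN (toℕ i)) (m<n⇒m%n≡m (Finₚ.toℕ<n i)))

  negN-zero : negN {n} zero ≡ zero
  negN-zero = Finₚ.toℕ-injective (trans (toℕ-modN n) (n%n≡0 n))

  addN-identityʳ : ∀ (i : Fin n) → addN i zero ≡ i
  addN-identityʳ i = Finₚ.toℕ-injective (begin
    toℕ (addN i zero)   ≡⟨ toℕ-modN (toℕ i ℕ.+ 0) ⟩
    (toℕ i ℕ.+ 0) ℕ.% n ≡⟨ cong (ℕ._% n) (ℕₚ.+-identityʳ (toℕ i)) ⟩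
    toℕ i ℕ.% n         ≡⟨ m<n⇒m%n≡m (Finₚ.toℕ<n i) ⟩
    toℕ i               ∎)

  addN-inverseʳ : ∀ (i : Fin n) → addN i (negN i) ≡ zero
  addN-inverseʳ i = Finₚ.toℕ-injective (begin
    toℕ (addN i (negN i))                   ≡⟨ toℕ-modN (a ℕ.+ toℕ (negN i)) ⟩
    (a ℕ.+ toℕ (negN i)) ℕ.% n              ≡⟨ cong (λ x → (a ℕ.+ x) ℕ.% n) (toℕ-modN b) ⟩
    (a ℕ.+ b ℕ.% n) ℕ.% n                   ≡⟨ %-distribˡ-+ a (b ℕ.% n) n ⟩
    (a ℕ.% n ℕ.+ b ℕ.% n ℕ.% n) ℕ.% n       ≡⟨ cong (λ x → (a ℕ.% n ℕ.+ x) ℕ.% n) (m%n%n≡m%n b n) ⟩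
    (a ℕ.% n ℕ.+ b ℕ.% n) ℕ.% n             ≡⟨ %-distribˡ-+ a b n ⟨
    (a ℕ.+ b) ℕ.% n                         ≡⟨ cong (ℕ._% n) (ℕₚ.m+[n∸m]≡n (ℕₚ.<⇒≤ (Finₚ.toℕ<n i))) ⟩
    n ℕ.% n                                 ≡⟨ n%n≡0 n ⟩
    0                                       ∎)
    where
    a = toℕ i
    b = n ℕ.∸ a

  generator : Dih n
  generator = mk (modN 1) false

  generator-^ : ∀ k → generator ^ k ≡ mk (modN k) false
  generator-^ zero    = refl
  generator-^ (suc k) rewrite generator-^ k = cong (λ g → mk g false) (Finₚ.toℕ-injective (begin
    toℕ (addN (modN 1) (modN k))                ≡⟨ toℕ-modN (toℕ (modN {n} 1) ℕ.+ toℕ (modN {n} k)) ⟩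
    (toℕ (modN {n} 1) ℕ.+ toℕ (modN {n} k)) ℕ.% n ≡⟨ cong₂ (λ a b → (a ℕ.+ b) ℕ.% n) (toℕ-modN 1) (toℕ-modN k) ⟩
    (1 ℕ.% n ℕ.+ k ℕ.% n) ℕ.% n                 ≡⟨ %-distribˡ-+ 1 k n ⟨
    suc k ℕ.% n                                 ≡⟨ toℕ-modN (suc k) ⟨
    toℕ (modN (suc k))                          ∎))

  rotation∈⟨generator⟩ : ∀ (i : Fin n) → mk i false ∈⟨ generator ⟩
  rotation∈⟨generator⟩ i = toℕ i , sym (trans (generator-^ (toℕ i)) (cong (λ g → mk g false) (modN-toℕ i)))

  rotation-^ : ∀ (i : Fin n) k → Dih.ref (mk i false ^ k) ≡ false
  rotation-^ i zero    = refl
  rotation-^ i (suc k) = rotation·rotation (mk i false ^ k) (rotation-^ i k)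
    where
    rotation·rotation : ∀ x → Dih.ref x ≡ false → Dih.ref (mk i false · x) ≡ false
    rotation·rotation (mk _ false) _ = refl

  reflection·e : ∀ (j : Fin n) → mk j true · e ≡ mk j true
  reflection·e j = cong (λ g → mk g true) (trans (cong (addN j) negN-zero) (addN-identityʳ j))

  reflection-^ : ∀ (j : Fin n) k → mk j true ^ k ≡ e ⊎ mk j true ^ k ≡ mk j true
  reflection-^ j zero = inj₁ refl
  reflection-^ j (suc k) with reflection-^ j k
  ... | inj₁ s^k≡e rewrite s^k≡e = inj₂ (reflection·e j)
  ... | inj₂ s^k≡s rewrite s^k≡s = inj₁ (cong (λ g → mk g false) (addN-inverseʳ j))

  reflection-generates : ∀ {j : Fin n} {c} → mk j true ∈⟨ c ⟩ → c ≡ mk j true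
  reflection-generates {c = mk i false} (k , s≡c^k) with () ← trans (cong Dih.ref s≡c^k) (rotation-^ i k)
  reflection-generates {c = mk i true}  (k , s≡c^k) with reflection-^ i k
  ... | inj₁ c^k≡e = case trans s≡c^k c^k≡e of λ ()
  ... | inj₂ c^k≡c = sym (trans s≡c^k c^k≡c)

  Adj-sym : ∀ {x y : Dih n} → Adj x y → Adj y x
  Adj-sym (x≢y , c , x∈ , y∈) = x≢y ∘ sym , c , y∈ , x∈

  adj-rotations : ∀ {i j : Fin n} → i ≢ j → Adj (mk i false) (mk j false)
  adj-rotations i≢j = i≢j ∘ cong Dih.rot , generator , rotation∈⟨generator⟩ _ , rotation∈⟨generator⟩ _

  -- e is mk (modN 0) false, which computes to mk zero false.
  adj-identity-reflection : ∀ (j : Fin n) → Adj (mk zero false) (mk j true)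
  adj-identity-reflection j = (λ ()) , mk j true , (0 , refl) , (1 , sym (reflection·e j))

  ¬adj-rotation-reflection : ∀ {i j : Fin n} → i ≢ zero → ¬ Adj (mk i false) (mk j true)
  ¬adj-rotation-reflection {i} {j} i≢0 (_ , c , (k , r≡c^k) , s∈⟨c⟩) with refl ← reflection-generates s∈⟨c⟩
    with reflection-^ j k
  ... | inj₁ c^k≡e = i≢0 (cong Dih.rot (trans r≡c^k c^k≡e))
  ... | inj₂ c^k≡c = case trans r≡c^k c^k≡c of λ ()

  ¬adj-reflections : ∀ {i j : Fin n} → ¬ Adj (mk i true) (mk j true)
  ¬adj-reflections (s≢s′ , c , s∈⟨c⟩ , s′∈⟨c⟩) =
    s≢s′ (trans (sym (reflection-generates s∈⟨c⟩)) (reflection-generates s′∈⟨c⟩))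

  walk₀ : ∀ {u v : Dih n} → Walk u v 0 → u ≡ v
  walk₀ here = refl

  walk₁ : ∀ {u v : Dih n} → Walk u v 1 → Adj u v
  walk₁ (step u~v here) = u~v

  element : Fin n ⊎ Fin n → Dih n
  element (inj₁ i) = mk i false
  element (inj₂ i) = mk i true

  idx≡element : ∀ k → idx k ≡ element (splitAt n k)
  idx≡element k with splitAt n k
  ... | inj₁ _ = refl
  ... | inj₂ _ = refl

  module _ {D : Dih n → Dih n → ℕ} (isD : IsDistance D) where

    shortest : ∀ u v → Walk u v (D u v)
    shortest u v = proj₁ (isD u v)

    shortest-minimal : ∀ {u v} k → Walk u v k → D u v ≤ k
    shortest-minimal {u} {v} = proj₂ (isD u v)

    distance-refl : ∀ u → D u u ≡ 0
    distance-refl u = ℕₚ.n≤0⇒n≡0 (shortest-minimal 0 here)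

    distance-adjacent : ∀ {u v} → Adj u v → D u v ≡ 1
    distance-adjacent {u} {v} u~v@(u≢v , _) = ℕₚ.≤-antisym (shortest-minimal 1 (step u~v here)) (at-least (D u v) refl)
      where
      at-least : ∀ k → D u v ≡ k → 1 ≤ k
      at-least zero    D≡0 = ⊥-elim (u≢v (walk₀ (subst (Walk u v) D≡0 (shortest u v))))
      at-least (suc k) _   = ℕ.s≤s ℕ.z≤n

    distance-two : ∀ {u w v} → u ≢ v → ¬ Adj u v → Adj u w → Adj w v → D u v ≡ 2
    distance-two {u} {w} {v} u≢v u≁v u~w w~v =
      ℕₚ.≤-antisym (shortest-minimal 2 (step u~w (step w~v here))) (at-least (D u v) refl)
      where
      at-least : ∀ k → D u v ≡ k → 2 ≤ k
      at-least zero          D≡0 = ⊥-elim (u≢v (walk₀ (subst (Walk u v) D≡0 (shortest u v))))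
      at-least (suc zero)    D≡1 = ⊥-elim (u≁v (walk₁ (subst (Walk u v) D≡1 (shortest u v))))
      at-least (suc (suc k)) _   = ℕ.s≤s (ℕ.s≤s ℕ.z≤n)

    distance≡distanceBlocks : ∀ x y → + D (element x) (element y) ≡ distanceBlocks x y
    distance≡distanceBlocks (inj₁ i) (inj₁ j) with i Fin.≟ j
    ... | yes refl = trans (cong +_ (distance-refl (mk i false))) (cong (_-_ (+ 1)) (sym (δ-refl i)))
    ... | no  i≢j  = trans (cong +_ (distance-adjacent (adj-rotations i≢j))) (cong (_-_ (+ 1)) (sym (δ-≢ i≢j)))
    distance≡distanceBlocks (inj₁ zero) (inj₂ j) =
      cong +_ (distance-adjacent (adj-identity-reflection j))
    distance≡distanceBlocks (inj₁ (suc i)) (inj₂ j) =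
      cong +_ (distance-two (λ ()) (¬adj-rotation-reflection (λ ()))
                            (adj-rotations (λ ())) (adj-identity-reflection j))
    distance≡distanceBlocks (inj₂ i) (inj₁ zero) =
      cong +_ (distance-adjacent (Adj-sym (adj-identity-reflection i)))
    distance≡distanceBlocks (inj₂ i) (inj₁ (suc j)) =
      cong +_ (distance-two (λ ()) (¬adj-rotation-reflection (λ ()) ∘ Adj-sym)
                            (Adj-sym (adj-identity-reflection i)) (adj-rotations (λ ())))
    distance≡distanceBlocks (inj₂ i) (inj₂ j) with i Fin.≟ j
    ... | yes refl = trans (cong +_ (distance-refl (mk i true))) (cong (λ d → + 2 - + 2 * d) (sym (δ-refl i)))
    ... | no  i≢j  = trans (cong +_ (distance-two (i≢j ∘ cong Dih.rot) ¬adj-reflections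
                                                   (Adj-sym (adj-identity-reflection i)) (adj-identity-reflection j)))
                           (cong (λ d → + 2 - + 2 * d) (sym (δ-≢ i≢j)))

corollary3p4 : (n : ℕ) → {{_ : NonZero n}} → 3 ≤ n →
               (D : Dih n → Dih n → ℕ) → IsDistance D →
               det (λ i j → + D (idx i) (idx j)) ≢ + 0
corollary3p4 (suc (suc (suc m))) (ℕ.s≤s (ℕ.s≤s (ℕ.s≤s _))) D isD =
  subst (_≢ + 0) (sym (det-cong entries)) (det-distanceBlocks≢0 m (2 ℕ.+ m))
  where
  entries : (λ i j → + D (idx i) (idx j)) ≋ blocks (3 ℕ.+ m) distanceBlocks
  entries i j = trans (cong₂ (λ u v → + D u v) (idx≡element i) (idx≡element j))
                      (distance≡distanceBlocks isD (splitAt (3 ℕ.+ m) i) (splitAt (3 ℕ.+ m) j))
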